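{- For positive integers $m,n$, let $$a(m,n):=\frac{(-1)^{m-1}q^{2mn+m-1}}{(1+q^n)(1-q^{2m-1})}.$$ Then every coefficient of the power series expansion of $a(m,n)$ in $q$ is $-1$, $0$, or $1$. -}

module Defs where

open import Data.Nat using (ℕ; zero; suc; _∸_; _≡ᵇ_) renaming (_+_ to _+ℕ_; _*_ to _*ℕ_)
open import Data.Integer using (ℤ; 0ℤ; 1ℤ; -1ℤ; _+_; _*_; -_; _^_)
open import Data.List using (List; map; upTo)
open import Data.Bool using (if_then_else_)

FPS : Set
FPS = ℕ → ℤ

sumℤ : List ℤ → ℤ
sumℤ Data.List.[] = 0ℤ
sumℤ (x Data.List.∷ xs) = x + sumℤ xs

_⊛_ : FPS → FPS → FPS
(f ⊛ g) k = sumℤ (map (λ i → f i * g (k ∸ i)) (upTo (suc k)))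

_⊕_ : FPS → FPS → FPS
(f ⊕ g) k = f k + g k

mono : ℤ → ℕ → FPS
mono c d k = if k ≡ᵇ d then c else 0ℤ

denom : ℕ → ℕ → FPS
denom m n = (mono 1ℤ 0 ⊕ mono 1ℤ n) ⊛ (mono 1ℤ 0 ⊕ mono -1ℤ (2 *ℕ m ∸ 1))

numer : ℕ → ℕ → FPS
numer m n = mono (-1ℤ ^ (m ∸ 1)) (2 *ℕ m *ℕ n +ℕ m ∸ 1)

{-# OPTIONS --safe #-}
module Submission where

-- Put p = 2m − 1, N = 2mn + m − 1, s = (−1)^(m−1) and e = (1 + qⁿ) a. Then
-- e (1 − qᵖ) = s q^N, so e = s Σₜ q^(N + tp): its coefficients are s on the
-- progression N + pℕ and 0 elsewhere. As p is odd, this progression is closed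
-- under midpoints: if j and j + 2x lie on it, so does j + x.
-- From aₖ = eₖ − aₖ₋ₙ, along every chain k₀, k₀ + n, k₀ + 2n, … the coefficients
-- of a are, up to sign, the partial alternating sums of those of e. Two
-- consecutive support points of e on such a chain are an odd number of steps
-- apart (otherwise their midpoint would lie in between), so the nonzero terms
-- of these sums alternate in sign and every partial sum is 0 or ±s.

open import Defs
open import Data.Nat using (ℕ; zero; suc; _≤_; _<_; _∸_; z≤n; s≤s; _≤?_; _≟_)
  renaming (_+_ to _+ℕ_; _*_ to _*ℕ_)
open import Data.Nat.Properties
  using ( m+[n∸m]≡n; m∸[m∸n]≡n; m∸n≤m; ≰⇒>; ∸-monoʳ-<; m+n≮n; m+n≮m; m<n+m; m≤m+n
        ; m<1+n⇒m<n∨m≡n; +-identityʳ; +-comm; +-assoc; +-suc; +-cancelˡ-≡; +-cancelʳ-≡)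
open import Data.Nat.Induction using (<-rec)
open import Data.Nat.Divisibility using (_∣_; quotient; ∣m+n∣m⇒∣n; n∣m*n)
open import Data.Nat.Coprimality using (Coprime; coprime-divisor; coprime-+; 1-coprimeTo)
import Data.Nat.Tactic.RingSolver as ℕ-Solver
open import Data.Integer using (ℤ; 0ℤ; 1ℤ; -1ℤ; _+_; _*_; -_; _-_; _^_)
import Data.Integer.Properties as ℤ
open import Data.Integer.Tactic.RingSolver using (solve-∀)
open import Data.Fin using (toℕ; fromℕ<; punchIn)
open import Data.Fin.Properties using (toℕ-fromℕ<; toℕ-injective; toℕ≤pred[n]; punchInᵢ≢i)
open import Data.Vec.Functional using (Vector)
open import Data.List using (map; applyUpTo; upTo)
open import Data.List.Properties using (map-cong)
open import Algebra.Properties.CommutativeMonoid.Sum ℤ.+-0-commutativeMonoid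
  using (sum; sum-syntax; sum-cong-≗; sum-replicate-zero; sum-remove; ∑-distrib-+)
open import Data.Product using (_×_; _,_; ∃-syntax)
import Data.Product as Prod
open import Data.Sum using (_⊎_; inj₁; inj₂)
import Data.Sum as Sum
open import Data.Empty using (⊥-elim)
open import Function using (_∘_; id)
open import Relation.Nullary using (¬_; Dec; yes; no)
open import Relation.Binary.PropositionalEquality
  using (_≡_; _≢_; refl; sym; trans; cong; cong₂; subst; module ≡-Reasoning)

open ≡-Reasoning

shift : ℕ → FPS → FPS
shift zero    f k       = f k
shift (suc t) f zero    = 0ℤ
shift (suc t) f (suc k) = shift t f k

shift-< : ∀ {t k} (f : FPS) → k < t → shift t f k ≡ 0ℤ
shift-< {suc t} {zero}  f _         = refl
shift-< {suc t} {suc k} f (s≤s k<t) = shift-< f k<t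

shift-+ : ∀ t (f : FPS) k → shift t f (t +ℕ k) ≡ f k
shift-+ zero    f k = refl
shift-+ (suc t) f k = shift-+ t f k

shift-∸ : ∀ {t k} (f : FPS) → t ≤ k → shift t f k ≡ f (k ∸ t)
shift-∸ {t} {k} f t≤k = trans (cong (shift t f) (sym (m+[n∸m]≡n t≤k))) (shift-+ t f (k ∸ t))

shift-⊕ : ∀ t (f g : FPS) k → shift t (f ⊕ g) k ≡ (shift t f ⊕ shift t g) k
shift-⊕ zero    f g k       = refl
shift-⊕ (suc t) f g zero    = refl
shift-⊕ (suc t) f g (suc k) = shift-⊕ t f g k

shift-shift : ∀ t u (f : FPS) k → shift t (shift u f) k ≡ shift (t +ℕ u) f k
shift-shift zero    u f k       = refl
shift-shift (suc t) u f zero    = refl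
shift-shift (suc t) u f (suc k) = shift-shift t u f k

shift-mono : ∀ t c u k → shift t (mono c u) k ≡ mono c (t +ℕ u) k
shift-mono zero    c u k       = refl
shift-mono (suc t) c u zero    = refl
shift-mono (suc t) c u (suc k) = shift-mono t c u k

mono-≡ : ∀ c t k → k ≡ t → mono c t k ≡ c
mono-≡ c zero    .zero    refl = refl
mono-≡ c (suc t) .(suc t) refl = mono-≡ c t t refl

mono-≢ : ∀ c t k → k ≢ t → mono c t k ≡ 0ℤ
mono-≢ c zero    zero    k≢t = ⊥-elim (k≢t refl)
mono-≢ c (suc t) zero    k≢t = refl
mono-≢ c zero    (suc k) k≢t = refl
mono-≢ c (suc t) (suc k) k≢t = mono-≢ c t k (k≢t ∘ cong suc)

sumℤ-applyUpTo : ∀ (f : ℕ → ℤ) g n → sumℤ (map f (applyUpTo g n)) ≡ ∑[ i < n ] f (g (toℕ i))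
sumℤ-applyUpTo f g zero    = refl
sumℤ-applyUpTo f g (suc n) = cong (f (g 0) +_) (sumℤ-applyUpTo f (g ∘ suc) n)

⊛-as-∑ : ∀ f g k → (f ⊛ g) k ≡ ∑[ i < suc k ] (f (toℕ i) * g (k ∸ toℕ i))
⊛-as-∑ f g k = sumℤ-applyUpTo (λ i → f i * g (k ∸ i)) id (suc k)

∑-zero : ∀ {n} (v : Vector ℤ n) → (∀ i → v i ≡ 0ℤ) → sum v ≡ 0ℤ
∑-zero {n} v v≡0 = trans (sum-cong-≗ v≡0) (sum-replicate-zero n)

∑-single : ∀ {n} (v : Vector ℤ (suc n)) i → (∀ j → j ≢ i → v j ≡ 0ℤ) → sum v ≡ v i
∑-single v i off = begin
  sum v                          ≡⟨ sum-remove {i = i} v ⟩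
  v i + sum (v ∘ punchIn i)      ≡⟨ cong (v i +_) (∑-zero _ λ j → off (punchIn i j) (punchInᵢ≢i i j)) ⟩
  v i + 0ℤ                       ≡⟨ ℤ.+-identityʳ (v i) ⟩
  v i                            ∎

∑-toℕ-zero : ∀ k (w : ℕ → ℤ) → (∀ i → i ≤ k → w i ≡ 0ℤ) → ∑[ i < suc k ] w (toℕ i) ≡ 0ℤ
∑-toℕ-zero k w off = ∑-zero {suc k} (w ∘ toℕ) λ j → off (toℕ j) (toℕ≤pred[n] j)

∑-toℕ-single : ∀ k (w : ℕ → ℤ) {u} → u ≤ k → (∀ i → i ≤ k → i ≢ u → w i ≡ 0ℤ) →
               ∑[ i < suc k ] w (toℕ i) ≡ w u
∑-toℕ-single k w {u} u≤k off = begin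
  ∑[ i < suc k ] w (toℕ i)  ≡⟨ ∑-single (w ∘ toℕ) i₀ (λ j j≢i₀ → off (toℕ j) (toℕ≤pred[n] j) (j≢i₀ ∘ at-i₀)) ⟩
  w (toℕ i₀)                ≡⟨ cong w (toℕ-fromℕ< (s≤s u≤k)) ⟩
  w u                       ∎
  where
  i₀ = fromℕ< (s≤s u≤k)
  at-i₀ : ∀ {j} → toℕ j ≡ u → j ≡ i₀
  at-i₀ eq = toℕ-injective (trans eq (sym (toℕ-fromℕ< (s≤s u≤k))))

⊛-congʳ : ∀ f {g h} → (∀ j → g j ≡ h j) → ∀ k → (f ⊛ g) k ≡ (f ⊛ h) k
⊛-congʳ f g≗h k = cong sumℤ (map-cong (λ i → cong (f i *_) (g≗h (k ∸ i))) (upTo (suc k)))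

⊛-distribˡ-⊕ : ∀ f g h k → (f ⊛ (g ⊕ h)) k ≡ (f ⊛ g) k + (f ⊛ h) k
⊛-distribˡ-⊕ f g h k = begin
  (f ⊛ (g ⊕ h)) k                ≡⟨ ⊛-as-∑ f (g ⊕ h) k ⟩
  sum (λ i → f′ i * (g′ i + h′ i)) ≡⟨ sum-cong-≗ (λ i → ℤ.*-distribˡ-+ (f′ i) (g′ i) (h′ i)) ⟩
  sum (λ i → f′ i * g′ i + f′ i * h′ i) ≡⟨ ∑-distrib-+ (λ i → f′ i * g′ i) (λ i → f′ i * h′ i) ⟩
  sum (λ i → f′ i * g′ i) + sum (λ i → f′ i * h′ i) ≡⟨ cong₂ _+_ (⊛-as-∑ f g k) (⊛-as-∑ f h k) ⟨
  (f ⊛ g) k + (f ⊛ h) k          ∎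
  where
  f′ g′ h′ : Vector ℤ (suc k)
  f′ i = f (toℕ i)
  g′ i = g (k ∸ toℕ i)
  h′ i = h (k ∸ toℕ i)

⊛-distribʳ-⊕ : ∀ f g h k → ((g ⊕ h) ⊛ f) k ≡ (g ⊛ f) k + (h ⊛ f) k
⊛-distribʳ-⊕ f g h k = begin
  ((g ⊕ h) ⊛ f) k                ≡⟨ ⊛-as-∑ (g ⊕ h) f k ⟩
  sum (λ i → (g′ i + h′ i) * f′ i) ≡⟨ sum-cong-≗ (λ i → ℤ.*-distribʳ-+ (f′ i) (g′ i) (h′ i)) ⟩
  sum (λ i → g′ i * f′ i + h′ i * f′ i) ≡⟨ ∑-distrib-+ (λ i → g′ i * f′ i) (λ i → h′ i * f′ i) ⟩
  sum (λ i → g′ i * f′ i) + sum (λ i → h′ i * f′ i) ≡⟨ cong₂ _+_ (⊛-as-∑ g f k) (⊛-as-∑ h f k) ⟨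
  (g ⊛ f) k + (h ⊛ f) k          ∎
  where
  f′ g′ h′ : Vector ℤ (suc k)
  f′ i = f (k ∸ toℕ i)
  g′ i = g (toℕ i)
  h′ i = h (toℕ i)

⊛-monoʳ : ∀ f c t k → (f ⊛ mono c t) k ≡ shift t f k * c
⊛-monoʳ f c t k = trans (⊛-as-∑ f (mono c t) k) (by-cases (t ≤? k))
  where
  term : ℕ → ℤ
  term i = f i * mono c t (k ∸ i)
  by-cases : Dec (t ≤ k) → ∑[ i < suc k ] term (toℕ i) ≡ shift t f k * c
  by-cases (yes t≤k) = begin
    ∑[ i < suc k ] term (toℕ i)         ≡⟨ ∑-toℕ-single k term (m∸n≤m k t) off ⟩
    f (k ∸ t) * mono c t (k ∸ (k ∸ t))  ≡⟨ cong₂ _*_ (sym (shift-∸ f t≤k)) (mono-≡ c t _ (m∸[m∸n]≡n t≤k)) ⟩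
    shift t f k * c                     ∎
    where
    off : ∀ i → i ≤ k → i ≢ k ∸ t → term i ≡ 0ℤ
    off i i≤k i≢k∸t = trans (cong (f i *_) (mono-≢ c t (k ∸ i) λ k∸i≡t →
        i≢k∸t (trans (sym (m∸[m∸n]≡n i≤k)) (cong (k ∸_) k∸i≡t)))) (ℤ.*-zeroʳ (f i))
  by-cases (no t≰k) = begin
    ∑[ i < suc k ] term (toℕ i)  ≡⟨ ∑-toℕ-zero k term off ⟩
    0ℤ                           ≡⟨ sym (ℤ.*-zeroˡ c) ⟩
    0ℤ * c                       ≡⟨ cong (_* c) (sym (shift-< f (≰⇒> t≰k))) ⟩
    shift t f k * c              ∎
    where
    off : ∀ i → i ≤ k → term i ≡ 0ℤ
    off i i≤k = trans (cong (f i *_) (mono-≢ c t (k ∸ i) λ k∸i≡t →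
        t≰k (subst (_≤ k) k∸i≡t (m∸n≤m k i)))) (ℤ.*-zeroʳ (f i))

⊛-monoˡ : ∀ c t g k → (mono c t ⊛ g) k ≡ c * shift t g k
⊛-monoˡ c t g k = trans (⊛-as-∑ (mono c t) g k) (by-cases (t ≤? k))
  where
  term : ℕ → ℤ
  term i = mono c t i * g (k ∸ i)
  off : ∀ i → i ≢ t → term i ≡ 0ℤ
  off i i≢t = trans (cong (_* g (k ∸ i)) (mono-≢ c t i i≢t)) (ℤ.*-zeroˡ (g (k ∸ i)))
  by-cases : Dec (t ≤ k) → ∑[ i < suc k ] term (toℕ i) ≡ c * shift t g k
  by-cases (yes t≤k) = begin
    ∑[ i < suc k ] term (toℕ i)  ≡⟨ ∑-toℕ-single k term t≤k (λ i _ → off i) ⟩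
    mono c t t * g (k ∸ t)       ≡⟨ cong₂ _*_ (mono-≡ c t t refl) (sym (shift-∸ g t≤k)) ⟩
    c * shift t g k              ∎
  by-cases (no t≰k) = begin
    ∑[ i < suc k ] term (toℕ i)  ≡⟨ ∑-toℕ-zero k term (λ i i≤k → off i λ i≡t → t≰k (subst (_≤ k) i≡t i≤k)) ⟩
    0ℤ                           ≡⟨ sym (ℤ.*-zeroʳ c) ⟩
    c * 0ℤ                       ≡⟨ cong (c *_) (sym (shift-< g (≰⇒> t≰k))) ⟩
    c * shift t g k              ∎

⊛-mono⊕mono : ∀ f c t c′ t′ k → (f ⊛ (mono c t ⊕ mono c′ t′)) k ≡ shift t f k * c + shift t′ f k * c′
⊛-mono⊕mono f c t c′ t′ k =
  trans (⊛-distribˡ-⊕ f (mono c t) (mono c′ t′) k) (cong₂ _+_ (⊛-monoʳ f c t k) (⊛-monoʳ f c′ t′ k))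

module Denominator (n p : ℕ) where

  denominator : FPS
  denominator = (mono 1ℤ 0 ⊕ mono 1ℤ n) ⊛ (mono 1ℤ 0 ⊕ mono -1ℤ p)

  denominator-monomials : ∀ j →
    denominator j ≡ ((mono 1ℤ 0 ⊕ mono -1ℤ p) ⊕ (mono 1ℤ n ⊕ mono -1ℤ (n +ℕ p))) j
  denominator-monomials j = begin
    denominator j
      ≡⟨ ⊛-distribʳ-⊕ 1-qᵖ (mono 1ℤ 0) (mono 1ℤ n) j ⟩
    (mono 1ℤ 0 ⊛ 1-qᵖ) j + (mono 1ℤ n ⊛ 1-qᵖ) j
      ≡⟨ cong₂ _+_ (⊛-monoˡ 1ℤ 0 1-qᵖ j) (⊛-monoˡ 1ℤ n 1-qᵖ j) ⟩
    1ℤ * 1-qᵖ j + 1ℤ * shift n 1-qᵖ j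
      ≡⟨ cong₂ _+_ (ℤ.*-identityˡ (1-qᵖ j)) (ℤ.*-identityˡ (shift n 1-qᵖ j)) ⟩
    1-qᵖ j + shift n 1-qᵖ j
      ≡⟨ cong (1-qᵖ j +_) (shift-⊕ n (mono 1ℤ 0) (mono -1ℤ p) j) ⟩
    1-qᵖ j + (shift n (mono 1ℤ 0) j + shift n (mono -1ℤ p) j)
      ≡⟨ cong (1-qᵖ j +_) (cong₂ _+_ (shift-mono n 1ℤ 0 j) (shift-mono n -1ℤ p j)) ⟩
    1-qᵖ j + (mono 1ℤ (n +ℕ 0) j + mono -1ℤ (n +ℕ p) j)
      ≡⟨ cong (λ t → 1-qᵖ j + (mono 1ℤ t j + mono -1ℤ (n +ℕ p) j)) (+-identityʳ n) ⟩
    1-qᵖ j + (mono 1ℤ n j + mono -1ℤ (n +ℕ p) j)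
      ∎
    where
    1-qᵖ : FPS
    1-qᵖ = mono 1ℤ 0 ⊕ mono -1ℤ p

  ⊛-denominator : ∀ f k → (f ⊛ denominator) k ≡ (f ⊕ shift n f) k - shift p (f ⊕ shift n f) k
  ⊛-denominator f k = begin
    (f ⊛ denominator) k
      ≡⟨ ⊛-congʳ f denominator-monomials k ⟩
    (f ⊛ ((mono 1ℤ 0 ⊕ mono -1ℤ p) ⊕ (mono 1ℤ n ⊕ mono -1ℤ (n +ℕ p)))) k
      ≡⟨ ⊛-distribˡ-⊕ f (mono 1ℤ 0 ⊕ mono -1ℤ p) (mono 1ℤ n ⊕ mono -1ℤ (n +ℕ p)) k ⟩
    (f ⊛ (mono 1ℤ 0 ⊕ mono -1ℤ p)) k + (f ⊛ (mono 1ℤ n ⊕ mono -1ℤ (n +ℕ p))) k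
      ≡⟨ cong₂ _+_ (⊛-mono⊕mono f 1ℤ 0 -1ℤ p k) (⊛-mono⊕mono f 1ℤ n -1ℤ (n +ℕ p) k) ⟩
    (f k * 1ℤ + shift p f k * -1ℤ) + (shift n f k * 1ℤ + shift (n +ℕ p) f k * -1ℤ)
      ≡⟨ collect (f k) (shift p f k) (shift n f k) (shift (n +ℕ p) f k) ⟩
    (f k + shift n f k) - (shift p f k + shift (n +ℕ p) f k)
      ≡⟨ cong (λ x → (f k + shift n f k) - (shift p f k + x)) shift-n+p ⟩
    (f k + shift n f k) - (shift p f k + shift p (shift n f) k)
      ≡⟨ cong (λ x → (f k + shift n f k) - x) (shift-⊕ p f (shift n f) k) ⟨
    (f ⊕ shift n f) k - shift p (f ⊕ shift n f) k
      ∎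
    where
    collect : ∀ x y z w → (x * 1ℤ + y * -1ℤ) + (z * 1ℤ + w * -1ℤ) ≡ (x + z) - (y + w)
    collect = solve-∀
    shift-n+p : shift (n +ℕ p) f k ≡ shift p (shift n f) k
    shift-n+p = trans (cong (λ t → shift t f k) (+-comm n p)) (sym (shift-shift p n f k))

  recurrence : ∀ (a c : FPS) → (∀ k → (a ⊛ denominator) k ≡ c k) →
               ∀ k → (a ⊕ shift n a) k ≡ c k + shift p (a ⊕ shift n a) k
  recurrence a c a⊛denominator≡c k = begin
    e k                                ≡⟨ minus-plus (e k) (shift p e k) ⟩
    (e k - shift p e k) + shift p e k  ≡⟨ cong (_+ shift p e k) (⊛-denominator a k) ⟨
    (a ⊛ denominator) k + shift p e k  ≡⟨ cong (_+ shift p e k) (a⊛denominator≡c k) ⟩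
    c k + shift p e k                  ∎
    where
    e : FPS
    e = a ⊕ shift n a
    minus-plus : ∀ x y → x ≡ (x - y) + y
    minus-plus = solve-∀

strided-induction : ∀ {P : ℕ → Set} {t} → 1 ≤ t →
                    (∀ {k} → k < t → P k) → (∀ {k} → P k → P (t +ℕ k)) → ∀ k → P k
strided-induction {P} {t} 1≤t below step = <-rec P go
  where
  go : ∀ k → (∀ {j} → j < k → P j) → P k
  go k rec with t ≤? k
  ... | no  t≰k = below (≰⇒> t≰k)
  ... | yes t≤k = subst P (m+[n∸m]≡n t≤k) (step (rec (∸-monoʳ-< 1≤t t≤k)))

ScaledIndicator : FPS → ℤ → (ℕ → Set) → ℕ → Set
ScaledIndicator e s P k = (P k × e k ≡ s) ⊎ (¬ P k × e k ≡ 0ℤ)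

module GeometricSeries (p N : ℕ) where

  OnProgression : ℕ → Set
  OnProgression k = ∃[ t ] k ≡ t *ℕ p +ℕ N

  progression-step : ∀ {x} → OnProgression x → OnProgression (p +ℕ x)
  progression-step (t , refl) = suc t , sym (+-assoc p (t *ℕ p) N)

  progression-cases : ∀ {k} → OnProgression k → k ≡ N ⊎ ∃[ x ] (k ≡ p +ℕ x × OnProgression x)
  progression-cases (zero  , k≡N)  = inj₁ k≡N
  progression-cases (suc t , refl) = inj₂ (t *ℕ p +ℕ N , +-assoc p (t *ℕ p) N , t , refl)

  ¬progression-below : ∀ {k} → k < N → ¬ OnProgression k
  ¬progression-below k<N (t , refl) = m+n≮n (t *ℕ p) N k<N

  progression-midpoint : Coprime p 2 → ∀ {j} x →
                         OnProgression j → OnProgression (2 *ℕ x +ℕ j) → OnProgression (x +ℕ j)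
  progression-midpoint p⊥2 x (t , refl) (t′ , eq) = quotient p∣x +ℕ t , (begin
    x +ℕ (t *ℕ p +ℕ N)                  ≡⟨ cong (_+ℕ (t *ℕ p +ℕ N)) (_∣_.equality p∣x) ⟩
    quotient p∣x *ℕ p +ℕ (t *ℕ p +ℕ N)  ≡⟨ factor (quotient p∣x) t p N ⟩
    (quotient p∣x +ℕ t) *ℕ p +ℕ N      ∎)
    where
    swap-middle : ∀ a b c → a +ℕ (b +ℕ c) ≡ (b +ℕ a) +ℕ c
    swap-middle = ℕ-Solver.solve-∀
    factor : ∀ u t p N → u *ℕ p +ℕ (t *ℕ p +ℕ N) ≡ (u +ℕ t) *ℕ p +ℕ N
    factor = ℕ-Solver.solve-∀
    t′p≡tp+2x : t′ *ℕ p ≡ t *ℕ p +ℕ 2 *ℕ x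
    t′p≡tp+2x = +-cancelʳ-≡ N _ _ (trans (sym eq) (swap-middle (2 *ℕ x) (t *ℕ p) N))
    p∣x : p ∣ x
    p∣x = coprime-divisor p⊥2 (∣m+n∣m⇒∣n (subst (p ∣_) t′p≡tp+2x (n∣m*n t′)) (n∣m*n t))

  coefficient : ∀ {e s} → 1 ≤ p → (∀ k → e k ≡ mono s N k + shift p e k) →
                ∀ k → ScaledIndicator e s OnProgression k
  coefficient {e} {s} 1≤p e-rec = strided-induction 1≤p below step
    where
    below : ∀ {k} → k < p → ScaledIndicator e s OnProgression k
    below {k} k<p with k ≟ N
    ... | yes refl = inj₁ ((0 , refl) , (begin
      e k                         ≡⟨ e-rec k ⟩
      mono s k k + shift p e k    ≡⟨ cong₂ _+_ (mono-≡ s k k refl) (shift-< e k<p) ⟩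
      s + 0ℤ                      ≡⟨ ℤ.+-identityʳ s ⟩
      s                           ∎))
    ... | no k≢N = inj₂ (off , trans (e-rec k) (cong₂ _+_ (mono-≢ s N k k≢N) (shift-< e k<p)))
      where
      off : ¬ OnProgression k
      off on with progression-cases on
      ... | inj₁ k≡N            = k≢N k≡N
      ... | inj₂ (x , refl , _) = m+n≮m p x k<p

    step : ∀ {x} → ScaledIndicator e s OnProgression x → ScaledIndicator e s OnProgression (p +ℕ x)
    step {x} ex with p +ℕ x ≟ N
    ... | yes p+x≡N = inj₁ ((0 , p+x≡N) , (begin
      e (p +ℕ x)                              ≡⟨ e-rec (p +ℕ x) ⟩
      mono s N (p +ℕ x) + shift p e (p +ℕ x)  ≡⟨ cong₂ _+_ (mono-≡ s N (p +ℕ x) p+x≡N) (shift-+ p e x) ⟩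
      s + e x                                 ≡⟨ cong (s +_) ex≡0 ⟩
      s + 0ℤ                                  ≡⟨ ℤ.+-identityʳ s ⟩
      s                                       ∎))
      where
      x<N : x < N
      x<N = subst (x <_) p+x≡N (m<n+m x 1≤p)
      ex≡0 : e x ≡ 0ℤ
      ex≡0 = Sum.[ ⊥-elim ∘ ¬progression-below x<N ∘ Prod.proj₁ , Prod.proj₂ ] ex
    ... | no p+x≢N =
      Sum.map (Prod.map progression-step (trans e[p+x]≡ex)) (Prod.map off (trans e[p+x]≡ex)) ex
      where
      e[p+x]≡ex : e (p +ℕ x) ≡ e x
      e[p+x]≡ex = trans (e-rec (p +ℕ x))
        (trans (cong₂ _+_ (mono-≢ s N (p +ℕ x) p+x≢N) (shift-+ p e x)) (ℤ.+-identityˡ (e x)))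
      off : ¬ OnProgression x → ¬ OnProgression (p +ℕ x)
      off x-off on with progression-cases on
      ... | inj₁ p+x≡N           = p+x≢N p+x≡N
      ... | inj₂ (y , eq , y-on) = x-off (subst OnProgression (sym (+-cancelˡ-≡ p x y eq)) y-on)

parity : ∀ d → ∃[ c ] (d ≡ 2 *ℕ c ⊎ d ≡ suc (2 *ℕ c))
parity zero = 0 , inj₁ refl
parity (suc d) with parity d
... | c , inj₁ d≡2c   = c , inj₂ (cong suc d≡2c)
... | c , inj₂ d≡1+2c = suc c , inj₁ (cong suc (trans d≡1+2c (sym (+-suc c (c +ℕ 0)))))

-1^even : ∀ c → -1ℤ ^ (2 *ℕ c) ≡ 1ℤ
-1^even c = trans (sym (ℤ.^-*-assoc -1ℤ 2 c)) (ℤ.^-zeroˡ c)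

-1^-cases : ∀ d → -1ℤ ^ d ≡ -1ℤ ⊎ -1ℤ ^ d ≡ 1ℤ
-1^-cases d with parity d
... | c , inj₁ d≡2c   = inj₂ (trans (cong (-1ℤ ^_) d≡2c) (-1^even c))
... | c , inj₂ d≡1+2c = inj₁ (trans (cong (-1ℤ ^_) d≡1+2c) (cong (-1ℤ *_) (-1^even c)))

module AlternatingSum {n : ℕ} (1≤n : 1 ≤ n) {Support : ℕ → Set}
  (support-midpoint : ∀ {j} x → Support j → Support (2 *ℕ x +ℕ j) → Support (x +ℕ j))
  {a : FPS} {s : ℤ} (e-coefficient : ∀ k → ScaledIndicator (a ⊕ shift n a) s Support k) where

  -- start is the last support point of e on the chain …, k − 2n, k − n, k.
  record Trailing (k : ℕ) : Set where
    field
      steps start      : ℕ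
      k≡               : k ≡ steps *ℕ n +ℕ start
      start-in-support : Support start
      gap              : ∀ {d} → d < steps → ¬ Support (suc d *ℕ n +ℕ start)
      value            : a k ≡ -1ℤ ^ steps * s

  Invariant : ℕ → Set
  Invariant k = a k ≡ 0ℤ ⊎ Trailing k

  trailing-start : ∀ {k} → Support k → a k ≡ s → Trailing k
  trailing-start {k} k-in ak≡s = record
    { steps = 0 ; start = k ; k≡ = refl ; start-in-support = k-in ; gap = λ ()
    ; value = trans ak≡s (sym (ℤ.*-identityˡ s)) }

  trailing-extend : ∀ {k} → ¬ Support (n +ℕ k) → a (n +ℕ k) ≡ - a k → Trailing k → Trailing (n +ℕ k)
  trailing-extend {k} n+k-out a[n+k]≡-ak tr = record
    { steps = suc steps ; start = start ; k≡ = n+k≡ ; start-in-support = start-in-support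
    ; gap = gap′
    ; value = trans a[n+k]≡-ak (trans (cong -_ value) (neg-* (-1ℤ ^ steps) s)) }
    where
    open Trailing tr
    neg-* : ∀ x y → - (x * y) ≡ (-1ℤ * x) * y
    neg-* = solve-∀
    n+k≡ : n +ℕ k ≡ suc steps *ℕ n +ℕ start
    n+k≡ = trans (cong (n +ℕ_) k≡) (sym (+-assoc n (steps *ℕ n) start))
    gap′ : ∀ {d} → d < suc steps → ¬ Support (suc d *ℕ n +ℕ start)
    gap′ d<1+steps with m<1+n⇒m<n∨m≡n d<1+steps
    ... | inj₁ d<steps = gap d<steps
    ... | inj₂ refl    = n+k-out ∘ subst Support (sym n+k≡)

  -- An odd run would put the midpoint of its two ends in the support, inside the gap.
  trailing-before-support : ∀ {k} → Support (n +ℕ k) → Trailing k → a k ≡ s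
  trailing-before-support {k} n+k-in tr with parity (Trailing.steps tr)
  ... | c , inj₁ steps≡2c = begin
    a k                  ≡⟨ value ⟩
    -1ℤ ^ steps * s      ≡⟨ cong (λ d → -1ℤ ^ d * s) steps≡2c ⟩
    -1ℤ ^ (2 *ℕ c) * s   ≡⟨ cong (_* s) (-1^even c) ⟩
    1ℤ * s               ≡⟨ ℤ.*-identityˡ s ⟩
    s                    ∎
    where open Trailing tr
  ... | c , inj₂ steps≡1+2c =
    ⊥-elim (gap c<steps (support-midpoint (suc c *ℕ n) start-in-support (subst Support n+k≡ n+k-in)))
    where
    open Trailing tr
    c<steps : c < steps
    c<steps = subst (c <_) (sym steps≡1+2c) (s≤s (m≤m+n c (c +ℕ 0)))
    regroup : ∀ n c j → n +ℕ (suc (2 *ℕ c) *ℕ n +ℕ j) ≡ 2 *ℕ (suc c *ℕ n) +ℕ j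
    regroup = ℕ-Solver.solve-∀
    n+k≡ : n +ℕ k ≡ 2 *ℕ (suc c *ℕ n) +ℕ start
    n+k≡ = trans (cong (n +ℕ_) (trans k≡ (cong (λ d → d *ℕ n +ℕ start) steps≡1+2c))) (regroup n c start)

  invariant : ∀ k → Invariant k
  invariant = strided-induction 1≤n below step
    where
    below : ∀ {k} → k < n → Invariant k
    below {k} k<n = by-cases (e-coefficient k)
      where
      ak≡ek : a k ≡ (a ⊕ shift n a) k
      ak≡ek = sym (trans (cong (a k +_) (shift-< a k<n)) (ℤ.+-identityʳ (a k)))
      by-cases : ScaledIndicator (a ⊕ shift n a) s Support k → Invariant k
      by-cases (inj₁ (k-in , ek≡s)) = inj₂ (trailing-start k-in (trans ak≡ek ek≡s))
      by-cases (inj₂ (_    , ek≡0)) = inj₁ (trans ak≡ek ek≡0)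

    step : ∀ {k} → Invariant k → Invariant (n +ℕ k)
    step {k} = by-cases (e-coefficient (n +ℕ k))
      where
      e′ = (a ⊕ shift n a) (n +ℕ k)
      minus-plus : ∀ x y → x ≡ (x + y) - y
      minus-plus = solve-∀
      a[n+k] : a (n +ℕ k) ≡ e′ - a k
      a[n+k] = trans (minus-plus (a (n +ℕ k)) (a k))
                     (cong (λ y → (a (n +ℕ k) + y) - a k) (sym (shift-+ n a k)))
      by-cases : ScaledIndicator (a ⊕ shift n a) s Support (n +ℕ k) → Invariant k → Invariant (n +ℕ k)
      by-cases (inj₁ (n+k-in , e′≡s)) (inj₁ ak≡0) =
        inj₂ (trailing-start n+k-in (trans a[n+k] (trans (cong₂ _-_ e′≡s ak≡0) (ℤ.+-identityʳ s))))
      by-cases (inj₁ (n+k-in , e′≡s)) (inj₂ tr) =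
        inj₁ (trans a[n+k] (trans (cong₂ _-_ e′≡s (trailing-before-support n+k-in tr)) (ℤ.+-inverseʳ s)))
      by-cases (inj₂ (n+k-out , e′≡0)) (inj₁ ak≡0) =
        inj₁ (trans a[n+k] (cong₂ _-_ e′≡0 ak≡0))
      by-cases (inj₂ (n+k-out , e′≡0)) (inj₂ tr) =
        inj₂ (trailing-extend n+k-out (trans a[n+k] (trans (cong (_- a k) e′≡0) (ℤ.+-identityˡ (- a k)))) tr)

  zero-or-signed : ∀ k → a k ≡ 0ℤ ⊎ ∃[ d ] a k ≡ -1ℤ ^ d * s
  zero-or-signed k = Sum.map₂ (λ tr → Trailing.steps tr , Trailing.value tr) (invariant k)

odd-coprime-2 : ∀ j → Coprime (suc (j *ℕ 2)) 2
odd-coprime-2 zero    = 1-coprimeTo 2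
odd-coprime-2 (suc j) = coprime-+ (odd-coprime-2 j)

2[1+m]∸1≡1+2m : ∀ m → 2 *ℕ suc m ∸ 1 ≡ suc (m *ℕ 2)
2[1+m]∸1≡1+2m m = unfolded m
  where
  -- 2 * suc m ∸ 1 computes to m + suc (m + 0)
  unfolded : ∀ m → m +ℕ suc (m +ℕ 0) ≡ suc (m *ℕ 2)
  unfolded = ℕ-Solver.solve-∀

unit-or-zero : ∀ {x} m → x ≡ 0ℤ ⊎ ∃[ d ] x ≡ -1ℤ ^ d * -1ℤ ^ m → x ≡ -1ℤ ⊎ x ≡ 0ℤ ⊎ x ≡ 1ℤ
unit-or-zero m (inj₁ x≡0)       = inj₂ (inj₁ x≡0)
unit-or-zero m (inj₂ (d , x≡±)) = Sum.map (trans x≡sign) (inj₂ ∘ trans x≡sign) (-1^-cases (d +ℕ m))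
  where
  x≡sign = trans x≡± (sym (ℤ.^-distribˡ-+-* -1ℤ d m))

proposition5p2 : (m n : ℕ) → 1 ≤ m → 1 ≤ n → (a : FPS)
    → (∀ k → (a ⊛ denom m n) k ≡ numer m n k)
    → ∀ k → a k ≡ -1ℤ ⊎ a k ≡ 0ℤ ⊎ a k ≡ 1ℤ
proposition5p2 (suc m) n _ 1≤n a a⊛denom≡numer k =
  unit-or-zero m (AlternatingSum.zero-or-signed 1≤n (progression-midpoint p⊥2) {a = a} e-coefficient k)
  where
  p = 2 *ℕ suc m ∸ 1
  open Denominator n p using (recurrence)
  open GeometricSeries p (2 *ℕ suc m *ℕ n +ℕ suc m ∸ 1) using (progression-midpoint; coefficient)
  p≡1+2m : p ≡ suc (m *ℕ 2)
  p≡1+2m = 2[1+m]∸1≡1+2m m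
  p⊥2 : Coprime p 2
  p⊥2 = subst (λ q → Coprime q 2) (sym p≡1+2m) (odd-coprime-2 m)
  e-coefficient = coefficient (subst (1 ≤_) (sym p≡1+2m) (s≤s z≤n))
                              (recurrence a (numer (suc m) n) a⊛denom≡numer)
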